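{- Let $\Sigma=\{0,1\}$ and let $R_1$ be the relation defined in the context. Then $R_1\subseteq(\Sigma\cup\{A\})^\omega\times(\Sigma\cup\{A\})^\omega$ is an infinitary rational relation.
   Context: $A$ is a letter not in $\Sigma$. $R_1$ is the set of pairs $(y_1,y_2)$ of $\omega$-words over $\Sigma\cup\{A\}$ for which there exist an integer $k\ge1$, words $U_k,V_k\in(\Sigma^\star A)^k$, a word $u\in\Sigma^\star$, and for all $i\ge1$ letters $t(i)\in\Sigma$, words $u_i,v_i\in0^\star$ and $g_i,z_i\in\Sigma^\star$ with $|v_i|=|u_i|$ and ($|g_i|=|z_i|+1$ or $|g_i|=|z_i|$), with $|g_i|=|z_i|$ for infinitely many $i$, such that $y_1=U_k\,u\,t(1)\,v_1\,A\,g_1\,t(3)\,v_2\,A\,g_2\,t(5)\,v_3\,A\cdots g_n\,t(2n+1)\,v_{n+1}\,A\cdots$ and $y_2=V_k\,u_1\,t(2)\,z_1\,A\,u_2\,t(4)\,z_2\,A\cdots u_n\,t(2n)\,z_n\,A\cdots$. A Büchi transducer $\mathcal{T}=(K,\Sigma_1,\Sigma_2,\Delta,q_0,F)$ has finite state set $K$, finite transition set $\Delta\subseteq K\times\Sigma_1^\star\times\Sigma_2^\star\times K$, initial state $q_0$, accepting set $F$; a computation is an infinite chain of transitions $(q_{i-1},u_i,v_i,q_i)$ starting at $q_0$, successful if some accepting state occurs infinitely often; an infinitary rational relation is the set of pairs $(u_1u_2\cdots,v_1v_2\cdots)\in\Sigma_1^\omega\times\Sigma_2^\omega$ arising from successful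 computations of some Büchi transducer. -}

module Defs where

open import Data.Nat using (ℕ; zero; suc; _+_; _≤_)
open import Data.Fin using (Fin; toℕ)
open import Data.Bool using (Bool; true)
open import Data.List using (List; []; _∷_; _++_; length; lookup; map; concat; replicate)
open import Data.List.Relation.Unary.All using (All)
open import Data.List.Membership.Propositional using (_∈_)
open import Data.Vec using (Vec; toList)
open import Data.Product using (Σ; ∃; ∃-syntax; _×_; _,_)
open import Data.Sum using (_⊎_)
open import Relation.Binary.PropositionalEquality using (_≡_)

ωWord : Set → Set
ωWord X = ℕ → X

L : {X : Set} → (ℕ → List X) → ℕ → ℕ
L w zero    = 0
L w (suc i) = L w i + length (w i)

-- x is the (infinite) concatenation w 0 · w 1 · w 2 ⋯ ,
-- which in particular requires this concatenation to be infinite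
IsConcat : {X : Set} → ωWord X → (ℕ → List X) → Set
IsConcat x w =
  (∀ i (j : Fin (length (w i))) → x (L w i + toℕ j) ≡ lookup (w i) j)
  × (∀ N → ∃[ i ] (N ≤ L w i))

Trans : Set → Set → ℕ → Set
Trans Σ₁ Σ₂ n = Fin n × List Σ₁ × List Σ₂ × Fin n

src : ∀ {Σ₁ Σ₂ n} → Trans Σ₁ Σ₂ n → Fin n
src (p , _ , _ , _) = p

tgt : ∀ {Σ₁ Σ₂ n} → Trans Σ₁ Σ₂ n → Fin n
tgt (_ , _ , _ , q) = q

inLab : ∀ {Σ₁ Σ₂ n} → Trans Σ₁ Σ₂ n → List Σ₁
inLab (_ , u , _ , _) = u

outLab : ∀ {Σ₁ Σ₂ n} → Trans Σ₁ Σ₂ n → List Σ₂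
outLab (_ , _ , v , _) = v

-- K = Fin nStates, Δ a finite list of transitions, F given by its
-- characteristic function
record BuchiTransducer (Σ₁ Σ₂ : Set) : Set where
  field
    nStates : ℕ
    Δ       : List (Trans Σ₁ Σ₂ nStates)
    q₀      : Fin nStates
    F       : Fin nStates → Bool

open BuchiTransducer public

-- a successful computation: infinite chain of transitions of Δ starting at
-- q₀ in which some accepting state occurs infinitely often
-- (the i-th state visited is src (ρ i))
IsSuccessfulComputation : ∀ {Σ₁ Σ₂} (T : BuchiTransducer Σ₁ Σ₂) →
  (ℕ → Trans Σ₁ Σ₂ (nStates T)) → Set
IsSuccessfulComputation T ρ =
  (∀ i → ρ i ∈ Δ T)
  × src (ρ 0) ≡ q₀ T
  × (∀ i → tgt (ρ i) ≡ src (ρ (suc i)))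
  × (∀ N → ∃[ i ] (N ≤ i × F T (src (ρ i)) ≡ true))

Rel∞ : ∀ {Σ₁ Σ₂} → BuchiTransducer Σ₁ Σ₂ → ωWord Σ₁ → ωWord Σ₂ → Set
Rel∞ T x y = ∃[ ρ ] (IsSuccessfulComputation T ρ
                     × IsConcat x (λ i → inLab (ρ i))
                     × IsConcat y (λ i → outLab (ρ i)))

IsInfinitaryRational : ∀ {Σ₁ Σ₂ : Set} → (ωWord Σ₁ → ωWord Σ₂ → Set) → Set
IsInfinitaryRational {Σ₁} {Σ₂} R =
  Σ (BuchiTransducer Σ₁ Σ₂) λ T →
    ∀ x y → (R x y → Rel∞ T x y) × (Rel∞ T x y → R x y)

data Bit : Set where
  b0 b1 : Bit

data Letter : Set where
  ⟨_⟩ : Bit → Letter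
  A   : Letter

emb : List Bit → List Letter
emb = map ⟨_⟩

-- the word of (Σ*A)^k given by k blocks w₁ A w₂ A ⋯ w_k A
blocksA : ∀ {k} → Vec (List Bit) k → List Letter
blocksA ws = concat (map (λ w → emb w ++ A ∷ []) (toList ws))

withPrefix : List Letter → (ℕ → List Letter) → ℕ → List Letter
withPrefix pre f zero    = pre
withPrefix pre f (suc n) = f n

IsZeros : List Bit → Set
IsZeros = All (_≡ b0)

-- The relation R₁ (sequences u,v,g,z,t are indexed as in the paper,
-- i.e. starting at 1; the entries at index 0 are unused).
--  y₁ = U_k u · [t(1) v₁ A g₁] · [t(3) v₂ A g₂] · ⋯ · [t(2n+1) v_{n+1} A g_{n+1}] ⋯
--  y₂ = V_k   · [u₁ t(2) z₁ A] · [u₂ t(4) z₂ A] · ⋯ · [u_n t(2n) z_n A] ⋯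
R₁ : ωWord Letter → ωWord Letter → Set
R₁ y₁ y₂ =
  Σ ℕ λ k → 1 ≤ k × Σ (Vec (List Bit) k) λ U → Σ (Vec (List Bit) k) λ V →
  Σ (List Bit) λ u → Σ (ℕ → Bit) λ t →
  Σ (ℕ → List Bit) λ us → Σ (ℕ → List Bit) λ vs →
  Σ (ℕ → List Bit) λ g → Σ (ℕ → List Bit) λ z →
    (∀ i → IsZeros (us (suc i)) × IsZeros (vs (suc i))
           × length (vs (suc i)) ≡ length (us (suc i))
           × (length (g (suc i)) ≡ suc (length (z (suc i)))
              ⊎ length (g (suc i)) ≡ length (z (suc i))))
    × (∀ N → ∃[ i ] (N ≤ i × length (g (suc i)) ≡ length (z (suc i))))
    × IsConcat y₁ (withPrefix (blocksA U ++ emb u)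
        (λ n → ⟨ t (suc (n + n)) ⟩ ∷ emb (vs (suc n)) ++ A ∷ emb (g (suc n))))
    × IsConcat y₂ (withPrefix (blocksA V)
        (λ n → emb (us (suc n)) ++ ⟨ t (suc (suc (n + n))) ⟩ ∷ emb (z (suc n)) ++ A ∷ []))

-- We exhibit a Büchi transducer T with seven states whose infinitary relation
-- is exactly R₁.  A computation of T reads y₁ and writes y₂ in phases: it
-- copies the blocks of U_k and V_k, reads u, and then repeats forever a
-- boundary transition reading t(2n+1), followed by an inner run that reads
-- v_n A g_n while writing u_n t(2n) z_n (the zeros in lockstep, then g_n
-- against z_n, allowing g_n one extra letter).  The boundary transition that
-- closes a pair g_n, z_n enters the accepting state sZa exactly when
-- |g_n| = |z_n|, so the Büchi condition is "|g_i| = |z_i| infinitely often".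

module Submission where

open import Defs
open import Data.Nat using (ℕ; zero; suc; _+_; _≤_; _<_; _∸_; z≤n; s≤s; _≤′_; ≤′-refl; ≤′-step)
open import Data.Nat.Properties
open import Data.Fin using (Fin; toℕ) renaming (zero to fz; suc to fs)
open import Data.List using (List; []; _∷_; [_]; _++_; length; lookup; map; concat; concatMap; applyUpTo; cartesianProductWith)
open import Data.List.Properties using (∷-injective; ++-assoc; ++-identityʳ; length-++; length-applyUpTo; applyUpTo-∷ʳ; map-applyUpTo; concat-++; concatMap-++)
open import Data.List.Relation.Unary.All as All using (All; []; _∷_)
open import Data.List.Relation.Unary.All.Properties using (++⁺; map⁺; cartesianProductWith⁺)
open import Data.List.Relation.Unary.Any using (here; there)
open import Data.List.Membership.Propositional using (_∈_)
open import Data.List.Membership.Propositional.Properties using (∈-++⁺ˡ; ∈-++⁺ʳ; ∈-map⁺; ∈-cartesianProductWith⁺)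
open import Data.Bool using (Bool; true; false)
open import Data.Unit using (⊤; tt)
open import Data.Product using (Σ; ∃-syntax; _×_; _,_; proj₁; proj₂)
open import Data.Sum as Sum using (_⊎_; inj₁; inj₂)
open import Data.Vec using (Vec; []; _∷_)
open import Data.Empty using (⊥; ⊥-elim)
open import Function using (_∘_)
open import Relation.Nullary using (¬_; yes; no)
open import Relation.Binary.PropositionalEquality hiding ([_])
open ≡-Reasoning

prefix : {X : Set} → (ℕ → List X) → ℕ → List X
prefix w n = concat (applyUpTo w n)

prefix-suc : ∀ {X : Set} (w : ℕ → List X) n → prefix w (suc n) ≡ prefix w n ++ w n
prefix-suc w n = begin
  concat (applyUpTo w (suc n))          ≡⟨ cong concat (sym (applyUpTo-∷ʳ w n)) ⟩
  concat (applyUpTo w n ++ [ w n ])     ≡⟨ sym (concat-++ (applyUpTo w n) [ w n ]) ⟩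
  prefix w n ++ (w n ++ [])             ≡⟨ cong (prefix w n ++_) (++-identityʳ (w n)) ⟩
  prefix w n ++ w n                     ∎

L≡length-prefix : ∀ {X : Set} (w : ℕ → List X) n → L w n ≡ length (prefix w n)
L≡length-prefix w zero    = refl
L≡length-prefix w (suc n) = begin
  L w n + length (w n)                  ≡⟨ cong (_+ length (w n)) (L≡length-prefix w n) ⟩
  length (prefix w n) + length (w n)    ≡⟨ sym (length-++ (prefix w n)) ⟩
  length (prefix w n ++ w n)            ≡⟨ cong length (sym (prefix-suc w n)) ⟩
  length (prefix w (suc n))             ∎

prefix-∘ : ∀ {X Y : Set} (f : X → List Y) (s : ℕ → X) m →
           prefix (f ∘ s) m ≡ concatMap f (applyUpTo s m)
prefix-∘ f s m = cong concat (sym (map-applyUpTo s f m))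

Agrees : {X : Set} → ωWord X → ℕ → List X → Set
Agrees x o []      = ⊤
Agrees x o (a ∷ l) = x o ≡ a × Agrees x (suc o) l

module _ {X : Set} (x : ωWord X) where

  agrees-++⁺ : ∀ o l₁ l₂ → Agrees x o l₁ → Agrees x (o + length l₁) l₂ → Agrees x o (l₁ ++ l₂)
  agrees-++⁺ o []       l₂ _        h rewrite +-identityʳ o = h
  agrees-++⁺ o (a ∷ l₁) l₂ (e , h₁) h rewrite +-suc o (length l₁) = e , agrees-++⁺ (suc o) l₁ l₂ h₁ h

  agrees-++⁻ˡ : ∀ o l₁ l₂ → Agrees x o (l₁ ++ l₂) → Agrees x o l₁
  agrees-++⁻ˡ o []       l₂ h       = tt
  agrees-++⁻ˡ o (a ∷ l₁) l₂ (e , h) = e , agrees-++⁻ˡ (suc o) l₁ l₂ h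

  agrees-++⁻ʳ : ∀ o l₁ l₂ → Agrees x o (l₁ ++ l₂) → Agrees x (o + length l₁) l₂
  agrees-++⁻ʳ o []       l₂ h rewrite +-identityʳ o = h
  agrees-++⁻ʳ o (a ∷ l₁) l₂ (e , h) rewrite +-suc o (length l₁) = agrees-++⁻ʳ (suc o) l₁ l₂ h

  agrees⇒lookup : ∀ o l → Agrees x o l → ∀ (j : Fin (length l)) → x (o + toℕ j) ≡ lookup l j
  agrees⇒lookup o (a ∷ l) (e , h) fz     rewrite +-identityʳ o = e
  agrees⇒lookup o (a ∷ l) (e , h) (fs j) rewrite +-suc o (toℕ j) = agrees⇒lookup (suc o) l h j

  lookup⇒agrees : ∀ o l → (∀ (j : Fin (length l)) → x (o + toℕ j) ≡ lookup l j) → Agrees x o l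
  lookup⇒agrees o []      h = tt
  lookup⇒agrees o (a ∷ l) h =
    subst (λ k → x k ≡ a) (+-identityʳ o) (h fz) ,
    lookup⇒agrees (suc o) l (λ j → subst (λ k → x k ≡ lookup l j) (+-suc o (toℕ j)) (h (fs j)))

  concat-agrees : ∀ {w} → IsConcat x w → ∀ n → Agrees x 0 (prefix w n)
  concat-agrees         c zero    = tt
  concat-agrees {w = w} c (suc n) =
    subst (Agrees x 0) (sym (prefix-suc w n))
      (agrees-++⁺ 0 (prefix w n) (w n) (concat-agrees c n)
        (subst (λ o → Agrees x o (w n)) (L≡length-prefix w n) (lookup⇒agrees (L w n) (w n) (proj₁ c n))))

_≼_ : {X : Set} → List X → List X → Set
l ≼ l' = ∃[ r ] (l ++ r ≡ l')

≼-trans : ∀ {X : Set} {l l' l'' : List X} → l ≼ l' → l' ≼ l'' → l ≼ l''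
≼-trans {l = l} (r , refl) (r' , refl) = r ++ r' , sym (++-assoc l r r')

≼-length : ∀ {X : Set} {l l' : List X} → l ≼ l' → length l ≤ length l'
≼-length {l = l} (r , refl) rewrite length-++ l {r} = m≤m+n (length l) (length r)

prefix-step : ∀ {X : Set} (w : ℕ → List X) n → prefix w n ≼ prefix w (suc n)
prefix-step w n = w n , sym (prefix-suc w n)

prefix-mono : ∀ {X : Set} (w : ℕ → List X) {m n} → m ≤ n → prefix w m ≼ prefix w n
prefix-mono w {m} le = go (≤⇒≤′ le)
  where
  go : ∀ {n} → m ≤′ n → prefix w m ≼ prefix w n
  go ≤′-refl            = [] , ++-identityʳ (prefix w m)
  go (≤′-step {n} m≤n) = ≼-trans (go m≤n) (prefix-step w n)

Cofinal : {X : Set} → (ℕ → List X) → (ℕ → List X) → Set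
Cofinal w w' = ∀ n → ∃[ m ] (prefix w n ≼ prefix w' m)

concat-transfer : ∀ {X : Set} (x : ωWord X) {w w'} → IsConcat x w → Cofinal w' w → Cofinal w w' → IsConcat x w'
concat-transfer x {w} {w'} c w'⊑w w⊑w' = letters , unbounded
  where
  -- Each prefix of w' lies inside a prefix of w, with which x agrees.
  agrees-w' : ∀ n → Agrees x 0 (prefix w' n)
  agrees-w' n with w'⊑w n
  ... | m , r , e = agrees-++⁻ˡ x 0 (prefix w' n) r (subst (Agrees x 0) (sym e) (concat-agrees x c m))
  letters : ∀ i (j : Fin (length (w' i))) → x (L w' i + toℕ j) ≡ lookup (w' i) j
  letters i =
    agrees⇒lookup x (L w' i) (w' i)
      (subst (λ o → Agrees x o (w' i)) (sym (L≡length-prefix w' i))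
        (agrees-++⁻ʳ x 0 (prefix w' i) (w' i) (subst (Agrees x 0) (prefix-suc w' i) (agrees-w' (suc i)))))
  unbounded : ∀ N → ∃[ i ] (N ≤ L w' i)
  unbounded N with proj₂ c N
  ... | i , N≤L with w⊑w' i
  ...   | m , le = m , ≤-trans N≤L (subst₂ _≤_ (sym (L≡length-prefix w i)) (sym (L≡length-prefix w' m)) (≼-length le))

regroup : ∀ {X : Set} (x : ωWord X) (w W : ℕ → List X) (c : ℕ → ℕ) →
          (∀ n → n ≤ c n) → (∀ n → prefix w (c n) ≡ prefix W (suc n)) →
          (IsConcat x w → IsConcat x W) × (IsConcat x W → IsConcat x w)
regroup x w W c n≤c cut =
  (λ h → concat-transfer x h W⊑w w⊑W) , (λ h → concat-transfer x h w⊑W W⊑w)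
  where
  w⊑W : Cofinal w W
  w⊑W n = suc n , ≼-trans (prefix-mono w (n≤c n)) ([] , trans (++-identityʳ _) (cut n))
  W⊑w : Cofinal W w
  W⊑w n = c n , ≼-trans (prefix-step W n) ([] , trans (++-identityʳ _) (sym (cut n)))

regroup-cuts : ∀ {X Y : Set} (x : ωWord Y) (lab : X → List Y) (ρ : ℕ → X) (W : ℕ → List Y)
  (c : ℕ → ℕ) (piece : ℕ → List X) → (∀ n → n ≤ c n) →
  concatMap lab (applyUpTo ρ (c 0)) ≡ W 0 →
  (∀ n → applyUpTo ρ (c (suc n)) ≡ applyUpTo ρ (c n) ++ piece n) →
  (∀ n → concatMap lab (piece n) ≡ W (suc n)) →
  (IsConcat x (lab ∘ ρ) → IsConcat x W) × (IsConcat x W → IsConcat x (lab ∘ ρ))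
regroup-cuts x lab ρ W c piece n≤c first cuts pieces =
  regroup x (lab ∘ ρ) W c n≤c (λ n → trans (prefix-∘ lab ρ (c n)) (labels n))
  where
  labels : ∀ n → concatMap lab (applyUpTo ρ (c n)) ≡ prefix W (suc n)
  labels zero    = trans first (sym (++-identityʳ (W 0)))
  labels (suc n) = begin
    concatMap lab (applyUpTo ρ (c (suc n)))                    ≡⟨ cong (concatMap lab) (cuts n) ⟩
    concatMap lab (applyUpTo ρ (c n) ++ piece n)               ≡⟨ concatMap-++ lab (applyUpTo ρ (c n)) (piece n) ⟩
    concatMap lab (applyUpTo ρ (c n)) ++ concatMap lab (piece n) ≡⟨ cong₂ _++_ (labels n) (pieces n) ⟩
    prefix W (suc n) ++ W (suc n)                              ≡⟨ sym (prefix-suc W (suc n)) ⟩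
    prefix W (suc (suc n))                                     ∎

applyUpTo-cong : ∀ {X : Set} {s s' : ℕ → X} → (∀ i → s i ≡ s' i) → ∀ m → applyUpTo s m ≡ applyUpTo s' m
applyUpTo-cong e zero    = refl
applyUpTo-cong e (suc m) = cong₂ _∷_ (e 0) (applyUpTo-cong (e ∘ suc) m)

applyUpTo-+ : ∀ {X : Set} (s : ℕ → X) m m' → applyUpTo s (m + m') ≡ applyUpTo s m ++ applyUpTo (λ i → s (m + i)) m'
applyUpTo-+ s zero    m' = refl
applyUpTo-+ s (suc m) m' = cong (s 0 ∷_) (applyUpTo-+ (s ∘ suc) m m')

applyUpTo-split : ∀ {X : Set} (s : ℕ → X) {p q} → p < q →
  applyUpTo s q ≡ applyUpTo s p ++ s p ∷ applyUpTo (λ i → s (suc p + i)) (q ∸ suc p)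
applyUpTo-split s {p} {q} p<q = begin
  applyUpTo s q                                              ≡⟨ cong (applyUpTo s) (sym p+[1+d]≡q) ⟩
  applyUpTo s (p + suc d)                                    ≡⟨ applyUpTo-+ s p (suc d) ⟩
  applyUpTo s p ++ s (p + 0) ∷ applyUpTo (λ i → s (p + suc i)) d
    ≡⟨ cong (λ l → applyUpTo s p ++ l)
         (cong₂ _∷_ (cong s (+-identityʳ p)) (applyUpTo-cong (λ i → cong s (+-suc p i)) d)) ⟩
  applyUpTo s p ++ s p ∷ applyUpTo (λ i → s (suc p + i)) d   ∎
  where
  d = q ∸ suc p
  p+[1+d]≡q : p + suc d ≡ q
  p+[1+d]≡q = trans (+-suc p d) (m+[n∸m]≡n p<q)

applyUpTo-at : ∀ {X : Set} (s : ℕ → X) M l₁ x l₂ → applyUpTo s M ≡ l₁ ++ x ∷ l₂ → s (length l₁) ≡ x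
applyUpTo-at s (suc M) []       x l₂ e = proj₁ (∷-injective e)
applyUpTo-at s (suc M) (y ∷ l₁) x l₂ e = applyUpTo-at (s ∘ suc) M l₁ x l₂ (proj₂ (∷-injective e))

-- Flattening a finite word followed by infinitely many nonempty blocks
-- (each given by its first element and the rest) into an ω-sequence.
blockList : {X : Set} → X × List X → List X
blockList (h , t) = h ∷ t

flatten : {X : Set} → List X → (ℕ → X × List X) → ℕ → X
flatten (x ∷ xs) B zero    = x
flatten (x ∷ xs) B (suc i) = flatten xs B i
flatten []       B zero    = proj₁ (B 0)
flatten []       B (suc i) = flatten (proj₂ (B 0)) (B ∘ suc) i

module _ {X : Set} where

  flatten-block : ∀ (cur : List X) B i → flatten cur B i ≡ flatten (cur ++ blockList (B 0)) (B ∘ suc) i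
  flatten-block []        B zero    = refl
  flatten-block []        B (suc i) = refl
  flatten-block (x ∷ cur) B zero    = refl
  flatten-block (x ∷ cur) B (suc i) = flatten-block cur B i

  flatten-blocks : ∀ n (cur : List X) B i →
    flatten cur B i ≡ flatten (cur ++ prefix (blockList ∘ B) n) (λ m → B (n + m)) i
  flatten-blocks zero    cur B i = cong (λ c → flatten c B i) (sym (++-identityʳ cur))
  flatten-blocks (suc n) cur B i = begin
    flatten cur B i
      ≡⟨ flatten-block cur B i ⟩
    flatten (cur ++ blockList (B 0)) (B ∘ suc) i
      ≡⟨ flatten-blocks n (cur ++ blockList (B 0)) (B ∘ suc) i ⟩
    flatten ((cur ++ blockList (B 0)) ++ prefix (blockList ∘ B ∘ suc) n) (λ m → B (suc n + m)) i
      ≡⟨ cong (λ c → flatten c (λ m → B (suc n + m)) i) (++-assoc cur (blockList (B 0)) _) ⟩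
    flatten (cur ++ prefix (blockList ∘ B) (suc n)) (λ m → B (suc n + m)) i ∎

  applyUpTo-flatten-own : ∀ (l : List X) B → applyUpTo (flatten l B) (length l) ≡ l
  applyUpTo-flatten-own []      B = refl
  applyUpTo-flatten-own (x ∷ l) B = cong (x ∷_) (applyUpTo-flatten-own l B)

  applyUpTo-flatten : ∀ (pre : List X) B n →
    applyUpTo (flatten pre B) (length (pre ++ prefix (blockList ∘ B) n)) ≡ pre ++ prefix (blockList ∘ B) n
  applyUpTo-flatten pre B n =
    trans (applyUpTo-cong (flatten-blocks n pre B) _) (applyUpTo-flatten-own (pre ++ prefix (blockList ∘ B) n) _)

module Increasing (b : ℕ → ℕ) (inc : ∀ n → b n < b (suc n)) where

  mono : ∀ {m n} → m ≤ n → b m ≤ b n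
  mono {m} m≤n = go (≤⇒≤′ m≤n)
    where
    go : ∀ {n} → m ≤′ n → b m ≤ b n
    go ≤′-refl            = ≤-refl
    go (≤′-step {n} m≤n) = ≤-trans (go m≤n) (<⇒≤ (inc n))

  strict : ∀ {m n} → m < n → b m < b n
  strict {m} m<n = <-≤-trans (inc m) (mono m<n)

  grows : ∀ n → n ≤ b n
  grows zero    = z≤n
  grows (suc n) = ≤-trans (s≤s (grows n)) (inc n)

  locate : ∀ j → b 0 ≤ j → ∃[ n ] (b n ≤ j × j < b (suc n))
  locate j b0≤j = go (suc j) 0 b0≤j (grows (suc j))
    where
    go : ∀ fuel n → b n ≤ j → j < b (n + fuel) → ∃[ n ] (b n ≤ j × j < b (suc n))
    go zero       n bn≤j j<b = ⊥-elim (<-irrefl refl (≤-<-trans bn≤j (subst (λ k → j < b k) (+-identityʳ n) j<b)))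
    go (suc fuel) n bn≤j j<b with j <? b (suc n)
    ... | yes j<b' = n , bn≤j , j<b'
    ... | no  j≮b' = go fuel (suc n) (≮⇒≥ j≮b') (subst (λ k → j < b k) (+-suc n fuel) j<b)

record Segmentation {X : Set} (ρ : ℕ → X) : Set where
  field
    pos    : ℕ → ℕ
    body   : ℕ → List X
    splits : ∀ n → applyUpTo ρ (pos (suc n)) ≡ applyUpTo ρ (pos n) ++ ρ (pos n) ∷ body n

module SegmentationProperties {X : Set} {ρ : ℕ → X} (S : Segmentation ρ) where
  open Segmentation S

  -- Each stretch is nonempty, so the positions strictly increase.
  pos-increasing : ∀ n → pos n < pos (suc n)
  pos-increasing n = subst (pos n <_) pos[1+n] (m<m+n (pos n) (s≤s z≤n))
    where
    pos[1+n] : pos n + suc (length (body n)) ≡ pos (suc n)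
    pos[1+n] = begin
      pos n + suc (length (body n))                            ≡⟨ cong (_+ _) (sym (length-applyUpTo ρ (pos n))) ⟩
      length (applyUpTo ρ (pos n)) + length (ρ (pos n) ∷ body n) ≡⟨ sym (length-++ (applyUpTo ρ (pos n))) ⟩
      length (applyUpTo ρ (pos n) ++ ρ (pos n) ∷ body n)       ≡⟨ cong length (sym (splits n)) ⟩
      length (applyUpTo ρ (pos (suc n)))                       ≡⟨ length-applyUpTo ρ (pos (suc n)) ⟩
      pos (suc n)                                              ∎

  pos-grows : ∀ n → n ≤ pos n
  pos-grows = Increasing.grows pos pos-increasing

  module _ {Y : Set} (x : ωWord Y) (lab : X → List Y) (W : ℕ → List Y) where

    heads-regroup : concatMap lab (applyUpTo ρ (pos 0)) ≡ W 0 →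
      (∀ n → lab (ρ (pos n)) ++ concatMap lab (body n) ≡ W (suc n)) →
      (IsConcat x (lab ∘ ρ) → IsConcat x W) × (IsConcat x W → IsConcat x (lab ∘ ρ))
    heads-regroup first blocks =
      regroup-cuts x lab ρ W pos (λ n → ρ (pos n) ∷ body n) pos-grows first splits blocks

    tails-regroup : concatMap lab (applyUpTo ρ (suc (pos 0))) ≡ W 0 →
      (∀ n → concatMap lab (body n) ++ lab (ρ (pos (suc n))) ≡ W (suc n)) →
      (IsConcat x (lab ∘ ρ) → IsConcat x W) × (IsConcat x W → IsConcat x (lab ∘ ρ))
    tails-regroup first blocks =
      regroup-cuts x lab ρ W (suc ∘ pos) piece (λ n → ≤-trans (pos-grows n) (n≤1+n _)) first cuts labels
      where
      piece : ℕ → List X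
      piece n = body n ++ [ ρ (pos (suc n)) ]
      cuts : ∀ n → applyUpTo ρ (suc (pos (suc n))) ≡ applyUpTo ρ (suc (pos n)) ++ piece n
      cuts n = begin
        applyUpTo ρ (suc (pos (suc n)))
          ≡⟨ sym (applyUpTo-∷ʳ ρ (pos (suc n))) ⟩
        applyUpTo ρ (pos (suc n)) ++ [ ρ (pos (suc n)) ]
          ≡⟨ cong (_++ [ ρ (pos (suc n)) ]) (splits n) ⟩
        (applyUpTo ρ (pos n) ++ ρ (pos n) ∷ body n) ++ [ ρ (pos (suc n)) ]
          ≡⟨ ++-assoc (applyUpTo ρ (pos n)) (ρ (pos n) ∷ body n) _ ⟩
        applyUpTo ρ (pos n) ++ [ ρ (pos n) ] ++ piece n
          ≡⟨ sym (++-assoc (applyUpTo ρ (pos n)) [ ρ (pos n) ] (piece n)) ⟩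
        (applyUpTo ρ (pos n) ++ [ ρ (pos n) ]) ++ piece n
          ≡⟨ cong (_++ piece n) (applyUpTo-∷ʳ ρ (pos n)) ⟩
        applyUpTo ρ (suc (pos n)) ++ piece n ∎
      labels : ∀ n → concatMap lab (piece n) ≡ W (suc n)
      labels n = begin
        concatMap lab (body n ++ [ ρ (pos (suc n)) ])
          ≡⟨ concatMap-++ lab (body n) _ ⟩
        concatMap lab (body n) ++ lab (ρ (pos (suc n))) ++ []
          ≡⟨ cong (concatMap lab (body n) ++_) (++-identityʳ _) ⟩
        concatMap lab (body n) ++ lab (ρ (pos (suc n)))
          ≡⟨ blocks n ⟩
        W (suc n) ∎

module _ {X : Set} (pre : List X) (B : ℕ → X × List X) where

  flattenPos : ℕ → ℕ
  flattenPos n = length (pre ++ prefix (blockList ∘ B) n)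

  flatten-cut : ∀ n → applyUpTo (flatten pre B) (flattenPos (suc n)) ≡
                      (pre ++ prefix (blockList ∘ B) n) ++ proj₁ (B n) ∷ proj₂ (B n)
  flatten-cut n = begin
    applyUpTo (flatten pre B) (flattenPos (suc n))     ≡⟨ applyUpTo-flatten pre B (suc n) ⟩
    pre ++ prefix (blockList ∘ B) (suc n)              ≡⟨ cong (pre ++_) (prefix-suc (blockList ∘ B) n) ⟩
    pre ++ prefix (blockList ∘ B) n ++ blockList (B n) ≡⟨ sym (++-assoc pre _ _) ⟩
    (pre ++ prefix (blockList ∘ B) n) ++ blockList (B n) ∎

  flatten-at : ∀ n → flatten pre B (flattenPos n) ≡ proj₁ (B n)
  flatten-at n = applyUpTo-at (flatten pre B) _ _ _ _ (flatten-cut n)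

  flatten-segmentation : Segmentation (flatten pre B)
  flatten-segmentation = record
    { pos    = flattenPos
    ; body   = proj₂ ∘ B
    ; splits = λ n → begin
        applyUpTo (flatten pre B) (flattenPos (suc n))
          ≡⟨ flatten-cut n ⟩
        (pre ++ prefix (blockList ∘ B) n) ++ proj₁ (B n) ∷ proj₂ (B n)
          ≡⟨ cong₂ (λ l h → l ++ h ∷ proj₂ (B n)) (sym (applyUpTo-flatten pre B n)) (sym (flatten-at n)) ⟩
        applyUpTo (flatten pre B) (flattenPos n) ++ flatten pre B (flattenPos n) ∷ proj₂ (B n) ∎
    }

record FirstRight {P Q : ℕ → Set} (d : ∀ j → P j ⊎ Q j) (N : ℕ) : Set where
  field
    at         : ℕ
    from       : N ≤ at
    right      : Q at
    leftBefore : ∀ j → N ≤ j → j < at → P j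

firstRight : ∀ {P Q : ℕ → Set} (d : ∀ j → P j ⊎ Q j) {N j} → N ≤ j → ¬ P j → FirstRight d N
firstRight {P = P} d {N} {j} N≤j ¬Pj = search (j ∸ N) N (m∸n+n≡m N≤j)
  where
  search : ∀ k M → k + M ≡ j → FirstRight d M
  search k M e with d M
  ... | inj₂ q = record { at = M ; from = ≤-refl ; right = q
                        ; leftBefore = λ i M≤i i<M → ⊥-elim (<-irrefl refl (≤-<-trans M≤i i<M)) }
  search zero    M e | inj₁ p = ⊥-elim (¬Pj (subst P e p))
  search (suc k) M e | inj₁ p = record
    { at = at ; from = ≤-trans (n≤1+n M) from ; right = right ; leftBefore = before }
    where
    open FirstRight (search k (suc M) (trans (+-suc k M) e))
    before : ∀ i → M ≤ i → i < at → P i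
    before i M≤i i<at with m≤n⇒m<n∨m≡n M≤i
    ... | inj₁ M<i  = leftBefore i M<i i<at
    ... | inj₂ refl = p

interleave : {X : Set} → (ℕ → X) → (ℕ → X) → ℕ → X
interleave f h zero          = f 0
interleave f h (suc zero)    = h 0
interleave f h (suc (suc m)) = interleave (f ∘ suc) (h ∘ suc) m

interleave-even : ∀ {X : Set} (f h : ℕ → X) n → interleave f h (n + n) ≡ f n
interleave-even f h zero    = refl
interleave-even f h (suc n) rewrite +-suc n n = interleave-even (f ∘ suc) (h ∘ suc) n

interleave-odd : ∀ {X : Set} (f h : ℕ → X) n → interleave f h (suc (n + n)) ≡ h n
interleave-odd f h zero    = refl
interleave-odd f h (suc n) rewrite +-suc n n = interleave-odd (f ∘ suc) (h ∘ suc) n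

-- The states of the transducer.
--   sP, sQ : copying the blocks of U_k and V_k (sQ: just after a letter A)
--   sU     : reading the word u
--   sZ, sZa: reading v_n against u_n (letters 0); sZa is the accepting copy of
--            sZ, entered exactly when the previous g_n, z_n had equal length
--   sG, sG': reading g_n against z_n (sG': g_n has one more letter than z_n)
St : Set
St = Fin 7

Tr : Set
Tr = Trans Letter Letter 7

pattern sP  = fz
pattern sQ  = fs fz
pattern sU  = fs (fs fz)
pattern sG  = fs (fs (fs fz))
pattern sG' = fs (fs (fs (fs fz)))
pattern sZa = fs (fs (fs (fs (fs fz))))
pattern sZ  = fs (fs (fs (fs (fs (fs fz)))))

data PQ : St → Set where
  pqP : PQ sP
  pqQ : PQ sQ

data QU : St → Set where
  quQ : QU sQ
  quU : QU sU

data ZZ : St → Set where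
  zza : ZZ sZa
  zz  : ZZ sZ

data Inner : Tr → Set where
  blockIn  : ∀ {s} → PQ s → (a : Bit) → Inner (s , [ ⟨ a ⟩ ] , [] , sP)
  blockOut : ∀ {s} → PQ s → (b : Bit) → Inner (s , [] , [ ⟨ b ⟩ ] , sP)
  blockEnd : ∀ {s} → PQ s → Inner (s , [ A ] , [ A ] , sQ)
  readU    : ∀ {s} → QU s → (a : Bit) → Inner (s , [ ⟨ a ⟩ ] , [] , sU)
  zeros    : ∀ {s} → ZZ s → Inner (s , [ ⟨ b0 ⟩ ] , [ ⟨ b0 ⟩ ] , sZ)
  openPair : ∀ {s} → ZZ s → (b : Bit) → Inner (s , [ A ] , [ ⟨ b ⟩ ] , sG)
  copy     : (a b : Bit) → Inner (sG , [ ⟨ a ⟩ ] , [ ⟨ b ⟩ ] , sG)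
  extra    : (a : Bit) → Inner (sG , [ ⟨ a ⟩ ] , [] , sG')

-- Boundary transitions: each reads a letter t(2n+1) of y₁ and starts the
-- n-th block of zeros; the later ones also write the A closing a block of y₂.
data Boundary : Tr → Set where
  startZeros  : ∀ {s} → QU s → (a : Bit) → Boundary (s , [ ⟨ a ⟩ ] , [] , sZ)
  closeEqual  : (a : Bit) → Boundary (sG , [ ⟨ a ⟩ ] , [ A ] , sZa)
  closeLonger : (a : Bit) → Boundary (sG' , [ ⟨ a ⟩ ] , [ A ] , sZ)

Step : Tr → Set
Step t = Inner t ⊎ Boundary t

bits : List Bit
bits = b0 ∷ b1 ∷ []

bit∈ : ∀ a → a ∈ bits
bit∈ b0 = here refl
bit∈ b1 = there (here refl)

PQs QUs ZZs : List St
PQs = sP ∷ sQ ∷ []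
QUs = sQ ∷ sU ∷ []
ZZs = sZa ∷ sZ ∷ []

PQ⇒∈ : ∀ {s} → PQ s → s ∈ PQs
PQ⇒∈ pqP = here refl
PQ⇒∈ pqQ = there (here refl)

∈⇒PQ : ∀ {s} → s ∈ PQs → PQ s
∈⇒PQ (here refl)         = pqP
∈⇒PQ (there (here refl)) = pqQ

QU⇒∈ : ∀ {s} → QU s → s ∈ QUs
QU⇒∈ quQ = here refl
QU⇒∈ quU = there (here refl)

∈⇒QU : ∀ {s} → s ∈ QUs → QU s
∈⇒QU (here refl)         = quQ
∈⇒QU (there (here refl)) = quU

ZZ⇒∈ : ∀ {s} → ZZ s → s ∈ ZZs
ZZ⇒∈ zza = here refl
ZZ⇒∈ zz  = there (here refl)

∈⇒ZZ : ∀ {s} → s ∈ ZZs → ZZ s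
∈⇒ZZ (here refl)         = zza
∈⇒ZZ (there (here refl)) = zz

blockInT blockOutT readUT openPairT startZerosT : St → Bit → Tr
blockInT    s a = s , [ ⟨ a ⟩ ] , [] , sP
blockOutT   s b = s , [] , [ ⟨ b ⟩ ] , sP
readUT      s a = s , [ ⟨ a ⟩ ] , [] , sU
openPairT   s b = s , [ A ] , [ ⟨ b ⟩ ] , sG
startZerosT s a = s , [ ⟨ a ⟩ ] , [] , sZ

blockEndT zerosT : St → Tr
blockEndT s = s , [ A ] , [ A ] , sQ
zerosT    s = s , [ ⟨ b0 ⟩ ] , [ ⟨ b0 ⟩ ] , sZ

copyT : Bit → Bit → Tr
copyT a b = sG , [ ⟨ a ⟩ ] , [ ⟨ b ⟩ ] , sG

extraT closeEqualT closeLongerT : Bit → Tr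
extraT       a = sG , [ ⟨ a ⟩ ] , [] , sG'
closeEqualT  a = sG , [ ⟨ a ⟩ ] , [ A ] , sZa
closeLongerT a = sG' , [ ⟨ a ⟩ ] , [ A ] , sZ

blockInΔ blockOutΔ blockEndΔ readUΔ zerosΔ openPairΔ copyΔ extraΔ : List Tr
blockInΔ  = cartesianProductWith blockInT PQs bits
blockOutΔ = cartesianProductWith blockOutT PQs bits
blockEndΔ = map blockEndT PQs
readUΔ    = cartesianProductWith readUT QUs bits
zerosΔ    = map zerosT ZZs
openPairΔ = cartesianProductWith openPairT ZZs bits
copyΔ     = cartesianProductWith copyT bits bits
extraΔ    = map extraT bits

startZerosΔ closeEqualΔ closeLongerΔ : List Tr
startZerosΔ  = cartesianProductWith startZerosT QUs bits
closeEqualΔ  = map closeEqualT bits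
closeLongerΔ = map closeLongerT bits

innerΔ boundaryΔ : List Tr
innerΔ    = blockInΔ ++ blockOutΔ ++ blockEndΔ ++ readUΔ ++ zerosΔ ++ openPairΔ ++ copyΔ ++ extraΔ
boundaryΔ = startZerosΔ ++ closeEqualΔ ++ closeLongerΔ

inner∈ : ∀ {t} → Inner t → t ∈ innerΔ
inner∈ (blockIn q a)  = ∈-++⁺ˡ (∈-cartesianProductWith⁺ blockInT (PQ⇒∈ q) (bit∈ a))
inner∈ (blockOut q b) = ∈-++⁺ʳ blockInΔ (∈-++⁺ˡ (∈-cartesianProductWith⁺ blockOutT (PQ⇒∈ q) (bit∈ b)))
inner∈ (blockEnd q)   = ∈-++⁺ʳ blockInΔ (∈-++⁺ʳ blockOutΔ (∈-++⁺ˡ (∈-map⁺ blockEndT (PQ⇒∈ q))))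
inner∈ (readU q a)    = ∈-++⁺ʳ blockInΔ (∈-++⁺ʳ blockOutΔ (∈-++⁺ʳ blockEndΔ (∈-++⁺ˡ
                          (∈-cartesianProductWith⁺ readUT (QU⇒∈ q) (bit∈ a)))))
inner∈ (zeros q)      = ∈-++⁺ʳ blockInΔ (∈-++⁺ʳ blockOutΔ (∈-++⁺ʳ blockEndΔ (∈-++⁺ʳ readUΔ (∈-++⁺ˡ
                          (∈-map⁺ zerosT (ZZ⇒∈ q))))))
inner∈ (openPair q b) = ∈-++⁺ʳ blockInΔ (∈-++⁺ʳ blockOutΔ (∈-++⁺ʳ blockEndΔ (∈-++⁺ʳ readUΔ
                          (∈-++⁺ʳ zerosΔ (∈-++⁺ˡ (∈-cartesianProductWith⁺ openPairT (ZZ⇒∈ q) (bit∈ b)))))))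
inner∈ (copy a b)     = ∈-++⁺ʳ blockInΔ (∈-++⁺ʳ blockOutΔ (∈-++⁺ʳ blockEndΔ (∈-++⁺ʳ readUΔ
                          (∈-++⁺ʳ zerosΔ (∈-++⁺ʳ openPairΔ (∈-++⁺ˡ
                            (∈-cartesianProductWith⁺ copyT (bit∈ a) (bit∈ b))))))))
inner∈ (extra a)      = ∈-++⁺ʳ blockInΔ (∈-++⁺ʳ blockOutΔ (∈-++⁺ʳ blockEndΔ (∈-++⁺ʳ readUΔ
                          (∈-++⁺ʳ zerosΔ (∈-++⁺ʳ openPairΔ (∈-++⁺ʳ copyΔ (∈-map⁺ extraT (bit∈ a))))))))

boundary∈ : ∀ {t} → Boundary t → t ∈ boundaryΔ
boundary∈ (startZeros q a) = ∈-++⁺ˡ (∈-cartesianProductWith⁺ startZerosT (QU⇒∈ q) (bit∈ a))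
boundary∈ (closeEqual a)   = ∈-++⁺ʳ startZerosΔ (∈-++⁺ˡ (∈-map⁺ closeEqualT (bit∈ a)))
boundary∈ (closeLonger a)  = ∈-++⁺ʳ startZerosΔ (∈-++⁺ʳ closeEqualΔ (∈-map⁺ closeLongerT (bit∈ a)))

innerΔ-sound : All Inner innerΔ
innerΔ-sound = ++⁺ blockIns (++⁺ blockOuts (++⁺ blockEnds (++⁺ readUs
                 (++⁺ zeroes (++⁺ openPairs (++⁺ copies extras))))))
  where
  blockIns : All Inner blockInΔ
  blockIns = cartesianProductWith⁺ (setoid St) (setoid Bit) blockInT PQs bits
               (λ {_} {a} s∈ _ → blockIn (∈⇒PQ s∈) a)
  blockOuts : All Inner blockOutΔ
  blockOuts = cartesianProductWith⁺ (setoid St) (setoid Bit) blockOutT PQs bits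
                (λ {_} {b} s∈ _ → blockOut (∈⇒PQ s∈) b)
  blockEnds : All Inner blockEndΔ
  blockEnds = map⁺ {xs = PQs} {f = blockEndT} (blockEnd pqP ∷ blockEnd pqQ ∷ [])
  readUs : All Inner readUΔ
  readUs = cartesianProductWith⁺ (setoid St) (setoid Bit) readUT QUs bits
             (λ {_} {a} s∈ _ → readU (∈⇒QU s∈) a)
  zeroes : All Inner zerosΔ
  zeroes = map⁺ {xs = ZZs} {f = zerosT} (zeros zza ∷ zeros zz ∷ [])
  openPairs : All Inner openPairΔ
  openPairs = cartesianProductWith⁺ (setoid St) (setoid Bit) openPairT ZZs bits
                (λ {_} {b} s∈ _ → openPair (∈⇒ZZ s∈) b)
  copies : All Inner copyΔ
  copies = cartesianProductWith⁺ (setoid Bit) (setoid Bit) copyT bits bits (λ {a} {b} _ _ → copy a b)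
  extras : All Inner extraΔ
  extras = map⁺ {xs = bits} {f = extraT} (extra b0 ∷ extra b1 ∷ [])

boundaryΔ-sound : All Boundary boundaryΔ
boundaryΔ-sound = ++⁺ starts (++⁺ equals longers)
  where
  starts : All Boundary startZerosΔ
  starts = cartesianProductWith⁺ (setoid St) (setoid Bit) startZerosT QUs bits
             (λ {_} {a} s∈ _ → startZeros (∈⇒QU s∈) a)
  equals : All Boundary closeEqualΔ
  equals = map⁺ {xs = bits} {f = closeEqualT} (closeEqual b0 ∷ closeEqual b1 ∷ [])
  longers : All Boundary closeLongerΔ
  longers = map⁺ {xs = bits} {f = closeLongerT} (closeLonger b0 ∷ closeLonger b1 ∷ [])

accepting : St → Bool
accepting sZa = true
accepting _   = false

T : BuchiTransducer Letter Letter
T = record { nStates = 7 ; Δ = innerΔ ++ boundaryΔ ; q₀ = sP ; F = accepting }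

step∈Δ : ∀ {t} → Step t → t ∈ Δ T
step∈Δ (inj₁ i) = ∈-++⁺ˡ (inner∈ i)
step∈Δ (inj₂ b) = ∈-++⁺ʳ innerΔ (boundary∈ b)

Δ⇒step : ∀ {t} → t ∈ Δ T → Step t
Δ⇒step = All.lookup (++⁺ (All.map inj₁ innerΔ-sound) (All.map inj₂ boundaryΔ-sound))

accepting⇒sZa : ∀ s → accepting s ≡ true → s ≡ sZa
accepting⇒sZa sP  ()
accepting⇒sZa sQ  ()
accepting⇒sZa sU  ()
accepting⇒sZa sG  ()
accepting⇒sZa sG' ()
accepting⇒sZa sZa _ = refl
accepting⇒sZa sZ  ()

data Run (R : Tr → Set) : St → List Tr → St → Set where
  []  : ∀ {s} → Run R s [] s
  _∷_ : ∀ {s u v q l s'} → R (s , u , v , q) → Run R q l s' → Run R s ((s , u , v , q) ∷ l) s'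

module _ {R : Tr → Set} where

  Run-++ : ∀ {s l q l' s'} → Run R s l q → Run R q l' s' → Run R s (l ++ l') s'
  Run-++ []       r' = r'
  Run-++ (x ∷ r) r' = x ∷ Run-++ r r'

  Run-map : ∀ {R' : Tr → Set} {s l s'} → (∀ {t} → R t → R' t) → Run R s l s' → Run R' s l s'
  Run-map f []      = []
  Run-map f (x ∷ r) = f x ∷ Run-map f r

  chain⇒run : ∀ (σ : ℕ → Tr) → (∀ i → tgt (σ i) ≡ src (σ (suc i))) →
    ∀ m → (∀ i → i < m → R (σ i)) → Run R (src (σ 0)) (applyUpTo σ m) (src (σ m))
  chain⇒run σ chain zero    steps = []
  chain⇒run σ chain (suc m) steps =
    steps 0 (s≤s z≤n) ∷
    subst (λ s → Run R s (applyUpTo (σ ∘ suc) m) (src (σ (suc m)))) (sym (chain 0))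
      (chain⇒run (σ ∘ suc) (chain ∘ suc) m (λ i i<m → steps (suc i) (s≤s i<m)))

  window⇒run : ∀ (ρ : ℕ → Tr) → (∀ i → tgt (ρ i) ≡ src (ρ (suc i))) →
    ∀ {p q} → p ≤ q → (∀ i → p ≤ i → i < q → R (ρ i)) →
    Run R (src (ρ p)) (applyUpTo (λ i → ρ (p + i)) (q ∸ p)) (src (ρ q))
  window⇒run ρ chain {p} {q} p≤q steps =
    subst₂ (λ a b → Run R (src (ρ a)) (applyUpTo (λ i → ρ (p + i)) (q ∸ p)) (src (ρ b)))
      (+-identityʳ p) (m+[n∸m]≡n p≤q)
      (chain⇒run (λ i → ρ (p + i))
        (λ i → subst (λ j → tgt (ρ (p + i)) ≡ src (ρ j)) (sym (+-suc p i)) (chain (p + i)))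
        (q ∸ p)
        (λ i i<q∸p → steps (p + i) (m≤m+n p i)
           (subst (p + i <_) (m+[n∸m]≡n p≤q) (+-monoʳ-< p i<q∸p))))

  run-start : ∀ (ρ : ℕ → Tr) M {s s'} → 0 < M → Run R s (applyUpTo ρ M) s' → src (ρ 0) ≡ s
  run-start ρ (suc M) _ (x ∷ r) = refl

  run⇒chain : ∀ (ρ : ℕ → Tr) M {s s'} → Run R s (applyUpTo ρ M) s' →
    ∀ i → suc i < M → R (ρ i) × tgt (ρ i) ≡ src (ρ (suc i))
  run⇒chain ρ (suc (suc M)) r zero    _         = first r
    where
    first : ∀ {s t t' l s'} → Run R s (t ∷ t' ∷ l) s' → R t × tgt t ≡ src t'
    first (x ∷ (x' ∷ r)) = x , refl
  run⇒chain ρ (suc M)       r (suc i) (s≤s i<M) = run⇒chain (ρ ∘ suc) M (rest r) i i<M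
    where
    rest : ∀ {s t l s'} → Run R s (t ∷ l) s' → Run R (tgt t) l s'
    rest (x ∷ r) = r

Labels : List Tr → List Letter → List Letter → Set
Labels l inp out = concatMap inLab l ≡ inp × concatMap outLab l ≡ out

labels-++ : ∀ {l l' i i' o o'} → Labels l i o → Labels l' i' o' → Labels (l ++ l') (i ++ i') (o ++ o')
labels-++ {l} {l'} (ri , wo) (ri' , wo') =
  trans (concatMap-++ inLab l l') (cong₂ _++_ ri ri') , trans (concatMap-++ outLab l l') (cong₂ _++_ wo wo')

record Segment (s s' : St) (inp out : List Letter) : Set where
  constructor segment
  field
    steps  : List Tr
    run    : Run Inner s steps s'
    labels : Labels steps inp out

open Segment

ε : ∀ {s} → Segment s s [] []
ε = segment [] [] (refl , refl)

_◅_ : ∀ {s i o q s' inp out} → Inner (s , i , o , q) → Segment q s' inp out → Segment s s' (i ++ inp) (o ++ out)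
_◅_ {i = i} {o = o} x (segment l r (ri , wo)) = segment _ (x ∷ r) (cong (i ++_) ri , cong (o ++_) wo)

_⊙_ : ∀ {s q s' i o i' o'} → Segment s q i o → Segment q s' i' o' → Segment s s' (i ++ i') (o ++ o')
segment l r lab ⊙ segment l' r' lab' = segment (l ++ l') (Run-++ r r') (labels-++ {l} {l'} lab lab')

infixr 5 _◅_ _⊙_

SegmentTo : (St → Set) → St → List Letter → List Letter → Set
SegmentTo P s inp out = ∃[ s' ] (P s' × Segment s s' inp out)

LengthCond : List Bit → List Bit → Set
LengthCond g z = length g ≡ suc (length z) ⊎ length g ≡ length z

data Balance (g z : List Bit) : St → Set where
  equal  : length g ≡ length z → Balance g z sG
  longer : length g ≡ suc (length z) → Balance g z sG'

balance⇒cond : ∀ {g z s} → Balance g z s → LengthCond g z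
balance⇒cond (equal e)  = inj₂ e
balance⇒cond (longer e) = inj₁ e

balance-∷ : ∀ {g z s a b} → Balance g z s → Balance (a ∷ g) (b ∷ z) s
balance-∷ (equal e)  = equal (cong suc e)
balance-∷ (longer e) = longer (cong suc e)

balanced-at-sG : ∀ {g z} → Balance g z sG → length g ≡ length z
balanced-at-sG (equal e) = e

balanced-end : ∀ {g z s} → Balance g z s → length g ≡ length z → s ≡ sG
balanced-end (equal _)  _ = refl
balanced-end (longer e) e' = ⊥-elim (1+n≢n (trans (sym e) e'))

blockSeg : ∀ {s} → PQ s → ∀ w w' → Segment s sQ (emb w ++ [ A ]) (emb w' ++ [ A ])
blockSeg q (a ∷ w) w'       = blockIn q a ◅ blockSeg pqP w w'
blockSeg q []      (b ∷ w') = blockOut q b ◅ blockSeg pqP [] w'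
blockSeg q []      []       = blockEnd q ◅ ε

blocksFromQ : ∀ {k} (U V : Vec (List Bit) k) → Segment sQ sQ (blocksA U) (blocksA V)
blocksFromQ []      []       = ε
blocksFromQ (w ∷ U) (w' ∷ V) = blockSeg pqQ w w' ⊙ blocksFromQ U V

-- From the initial state at least one block has to be read.
blocksFromP : ∀ {k} (U V : Vec (List Bit) (suc k)) → Segment sP sQ (blocksA U) (blocksA V)
blocksFromP (w ∷ U) (w' ∷ V) = blockSeg pqP w w' ⊙ blocksFromQ U V

uSeg : ∀ {s} → QU s → ∀ u → SegmentTo QU s (emb u) []
uSeg q []      = _ , q , ε
uSeg q (a ∷ u) with uSeg quU u
... | s' , q' , seg = s' , q' , readU q a ◅ seg

zeroSeg : ∀ {s vs us} → ZZ s → IsZeros vs → IsZeros us → length vs ≡ length us →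
          SegmentTo ZZ s (emb vs) (emb us)
zeroSeg q []          []          _ = _ , q , ε
zeroSeg q (refl ∷ zv) (refl ∷ zu) e with zeroSeg zz zv zu (suc-injective e)
... | s' , q' , seg = s' , q' , zeros q ◅ seg

pairSeg : ∀ g z → LengthCond g z → SegmentTo (Balance g z) sG (emb g) (emb z)
pairSeg []           []      _        = _ , equal refl , ε
pairSeg (a ∷ [])     []      _        = _ , longer refl , extra a ◅ ε
pairSeg (a ∷ g)      (b ∷ z) c with pairSeg g z (Sum.map suc-injective suc-injective c)
... | s' , bal , seg = s' , balance-∷ bal , copy a b ◅ seg
pairSeg []           (_ ∷ _) (inj₁ ())
pairSeg []           (_ ∷ _) (inj₂ ())
pairSeg (_ ∷ _ ∷ _)  []      (inj₁ ())
pairSeg (_ ∷ _ ∷ _)  []      (inj₂ ())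

tailSeg : ∀ {s vs us g z} → ZZ s → IsZeros vs → IsZeros us → length vs ≡ length us →
          (a : Bit) → LengthCond g z →
          SegmentTo (Balance g z) s (emb vs ++ A ∷ emb g) (emb us ++ ⟨ a ⟩ ∷ emb z)
tailSeg {g = g} {z} q zv zu e a c with zeroSeg q zv zu e | pairSeg g z c
... | _ , q' , zs | s' , bal , ps = s' , bal , zs ⊙ openPair q' a ◅ ps

closeTarget : St → St
closeTarget sG = sZa
closeTarget _  = sZ

closing : ∀ {g z s} → Balance g z s → (a : Bit) → Boundary (s , [ ⟨ a ⟩ ] , [ A ] , closeTarget s)
closing (equal _)  a = closeEqual a
closing (longer _) a = closeLonger a

closing-target : ∀ {g z s} → Balance g z s → ZZ (closeTarget s)
closing-target (equal _)  = zza
closing-target (longer _) = zz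

data Exit : St → Set where
  exitQ  : Exit sQ
  exitU  : Exit sU
  exitG  : Exit sG
  exitG' : Exit sG'

boundary-exit : ∀ {t} → Boundary t → Exit (src t)
boundary-exit (startZeros quQ _) = exitQ
boundary-exit (startZeros quU _) = exitU
boundary-exit (closeEqual _)     = exitG
boundary-exit (closeLonger _)    = exitG'

boundary-letter : ∀ {t} → Boundary t → ∃[ a ] (inLab t ≡ [ ⟨ a ⟩ ])
boundary-letter (startZeros _ a) = a , refl
boundary-letter (closeEqual a)   = a , refl
boundary-letter (closeLonger a)  = a , refl

boundary-target : ∀ {t} → Boundary t → ZZ (tgt t)
boundary-target (startZeros _ _) = zz
boundary-target (closeEqual _)   = zza
boundary-target (closeLonger _)  = zz

boundary-silent : ∀ {t} → Boundary t → QU (src t) → outLab t ≡ []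
boundary-silent (startZeros _ _) _ = refl

boundary-closes : ∀ {t g z} → Boundary t → Balance g z (src t) → outLab t ≡ [ A ]
boundary-closes (startZeros quQ _) ()
boundary-closes (startZeros quU _) ()
boundary-closes (closeEqual _)     _ = refl
boundary-closes (closeLonger _)    _ = refl

inner-avoids-sZa : ∀ {s u v} → Inner (s , u , v , sZa) → ⊥
inner-avoids-sZa ()

boundary-into-sZa : ∀ {s u v} → Boundary (s , u , v , sZa) → s ≡ sG
boundary-into-sZa (closeEqual _) = refl

parseU : ∀ {l s'} → Run Inner sU l s' → ∃[ u ] (QU s' × Labels l (emb u) [])
parseU []              = [] , quU , refl , refl
parseU (readU _ a ∷ r) with parseU r
... | u , q , ri , wo = a ∷ u , q , cong (⟨ a ⟩ ∷_) ri , wo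

record Prefix (k : ℕ) (l : List Tr) (s' : St) : Set where
  constructor prefixOf
  field
    U V    : Vec (List Bit) k
    u      : List Bit
    ends   : QU s'
    labels : Labels l (blocksA U ++ emb u) (blocksA V)

parseP : ∀ {l s'} → Exit s' → Run Inner sP l s' → ∃[ k ] Prefix (suc k) l s'
parseQ : ∀ {l s'} → Exit s' → Run Inner sQ l s' → ∃[ k ] Prefix k l s'

parseP () []
parseP e (blockIn _ a ∷ r) with parseP e r
... | k , prefixOf (w ∷ U) V u q (ri , wo) = k , prefixOf ((a ∷ w) ∷ U) V u q (cong (⟨ a ⟩ ∷_) ri , wo)
parseP e (blockOut _ b ∷ r) with parseP e r
... | k , prefixOf U (w ∷ V) u q (ri , wo) = k , prefixOf U ((b ∷ w) ∷ V) u q (ri , cong (⟨ b ⟩ ∷_) wo)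
parseP e (blockEnd _ ∷ r) with parseQ e r
... | k , prefixOf U V u q (ri , wo) = k , prefixOf ([] ∷ U) ([] ∷ V) u q (cong (A ∷_) ri , cong (A ∷_) wo)

parseQ e [] = 0 , prefixOf [] [] [] quQ (refl , refl)
parseQ e (blockIn _ a ∷ r) with parseP e r
... | k , prefixOf (w ∷ U) V u q (ri , wo) = suc k , prefixOf ((a ∷ w) ∷ U) V u q (cong (⟨ a ⟩ ∷_) ri , wo)
parseQ e (blockOut _ b ∷ r) with parseP e r
... | k , prefixOf U (w ∷ V) u q (ri , wo) = suc k , prefixOf U ((b ∷ w) ∷ V) u q (ri , cong (⟨ b ⟩ ∷_) wo)
parseQ e (blockEnd _ ∷ r) with parseQ e r
... | k , prefixOf U V u q (ri , wo) = suc k , prefixOf ([] ∷ U) ([] ∷ V) u q (cong (A ∷_) ri , cong (A ∷_) wo)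
parseQ e (readU _ a ∷ r) with parseU r
... | u , q , ri , wo = 0 , prefixOf [] [] (a ∷ u) q (cong (⟨ a ⟩ ∷_) ri , wo)

stuck-at-sG' : ∀ {u v q} → Inner (sG' , u , v , q) → ⊥
stuck-at-sG' (blockIn () _)
stuck-at-sG' (blockOut () _)
stuck-at-sG' (blockEnd ())
stuck-at-sG' (readU () _)
stuck-at-sG' (zeros ())
stuck-at-sG' (openPair () _)

parseG : ∀ {l s'} → Run Inner sG l s' → ∃[ g ] ∃[ z ] (Balance g z s' × Labels l (emb g) (emb z))
parseG []                 = [] , [] , equal refl , refl , refl
parseG (copy a b ∷ r) with parseG r
... | g , z , bal , ri , wo = a ∷ g , b ∷ z , balance-∷ bal , cong (⟨ a ⟩ ∷_) ri , cong (⟨ b ⟩ ∷_) wo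
parseG (extra a ∷ [])     = a ∷ [] , [] , longer refl , refl , refl
parseG (extra a ∷ (x ∷ _)) = ⊥-elim (stuck-at-sG' x)

record Tail (l : List Tr) (s' : St) : Set where
  constructor tailOf
  field
    vs us       : List Bit
    a           : Bit
    g z         : List Bit
    vs-zeros    : IsZeros vs
    us-zeros    : IsZeros us
    same-length : length vs ≡ length us
    balance     : Balance g z s'
    labels      : Labels l (emb vs ++ A ∷ emb g) (emb us ++ ⟨ a ⟩ ∷ emb z)

parseZ : ∀ {s l s'} → ZZ s → Exit s' → Run Inner s l s' → Tail l s'
parseZ zza () []
parseZ zz  () []
parseZ _ e (zeros _ ∷ r) with parseZ zz e r
... | tailOf vs us a g z zv zu same bal (ri , wo) =
  tailOf (b0 ∷ vs) (b0 ∷ us) a g z (refl ∷ zv) (refl ∷ zu) (cong suc same) bal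
         (cong (⟨ b0 ⟩ ∷_) ri , cong (⟨ b0 ⟩ ∷_) wo)
parseZ _ e (openPair _ a ∷ r) with parseG r
... | g , z , bal , ri , wo = tailOf [] [] a g z [] [] refl bal (cong (A ∷_) ri , cong (⟨ a ⟩ ∷_) wo)

blocks₁ : ∀ {k} → Vec (List Bit) k → List Bit → (ℕ → Bit) → (ℕ → List Bit) → (ℕ → List Bit) → ℕ → List Letter
blocks₁ U u t vs g =
  withPrefix (blocksA U ++ emb u) (λ n → ⟨ t (suc (n + n)) ⟩ ∷ emb (vs (suc n)) ++ A ∷ emb (g (suc n)))

blocks₂ : ∀ {k} → Vec (List Bit) k → (ℕ → Bit) → (ℕ → List Bit) → (ℕ → List Bit) → ℕ → List Letter
blocks₂ V t us z =
  withPrefix (blocksA V) (λ n → emb (us (suc n)) ++ ⟨ t (suc (suc (n + n))) ⟩ ∷ emb (z (suc n)) ++ A ∷ [])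

module Forward {k : ℕ} (U V : Vec (List Bit) (suc k)) (u : List Bit) (t : ℕ → Bit)
  (us vs g z : ℕ → List Bit)
  (cond : ∀ i → IsZeros (us (suc i)) × IsZeros (vs (suc i))
              × length (vs (suc i)) ≡ length (us (suc i)) × LengthCond (g (suc i)) (z (suc i)))
  (inf : ∀ N → ∃[ i ] (N ≤ i × length (g (suc i)) ≡ length (z (suc i))))
  where

  pre : SegmentTo QU sP (blocksA U ++ emb u) (blocksA V ++ [])
  pre = let s , q , seg = uSeg quQ u in s , q , blocksFromP U V ⊙ seg

  tailIn tailOut : ℕ → List Letter
  tailIn  n = emb (vs (suc n)) ++ A ∷ emb (g (suc n))
  tailOut n = emb (us (suc n)) ++ ⟨ t (suc (suc (n + n))) ⟩ ∷ emb (z (suc n))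

  tailFrom : ∀ {s} → ZZ s → ∀ n → SegmentTo (Balance (g (suc n)) (z (suc n))) s (tailIn n) (tailOut n)
  tailFrom q n = let zu , zv , same , c = cond n in tailSeg q zv zu same (t (suc (suc (n + n)))) c

  tailStart : ℕ → Σ St ZZ
  tailStart zero    = sZ , zz
  tailStart (suc n) = let s , bal , _ = tailFrom (proj₂ (tailStart n)) n in closeTarget s , closing-target bal

  tail : ∀ n → SegmentTo (Balance (g (suc n)) (z (suc n))) (proj₁ (tailStart n)) (tailIn n) (tailOut n)
  tail n = tailFrom (proj₂ (tailStart n)) n

  headSrc : ℕ → St
  headSrc zero    = proj₁ pre
  headSrc (suc n) = proj₁ (tail n)

  headOut : ℕ → List Letter
  headOut zero    = []
  headOut (suc n) = [ A ]

  head : ℕ → Tr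
  head n = headSrc n , [ ⟨ t (suc (n + n)) ⟩ ] , headOut n , proj₁ (tailStart n)

  head-boundary : ∀ n → Boundary (head n)
  head-boundary zero    = startZeros (proj₁ (proj₂ pre)) (t 1)
  head-boundary (suc n) = closing (proj₁ (proj₂ (tail n))) (t (suc (suc n + suc n)))

  block : ℕ → Tr × List Tr
  block n = head n , steps (proj₂ (proj₂ (tail n)))

  preSteps : List Tr
  preSteps = steps (proj₂ (proj₂ pre))

  ρ : ℕ → Tr
  ρ = flatten preSteps block

  S : Segmentation ρ
  S = flatten-segmentation preSteps block

  open Segmentation S
  open SegmentationProperties S

  block-run : ∀ n → Run Step (headSrc n) (blockList (block n)) (headSrc (suc n))
  block-run n = inj₂ (head-boundary n) ∷ Run-map inj₁ (run (proj₂ (proj₂ (tail n))))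

  blocks-run : ∀ n → Run Step sP (preSteps ++ prefix (blockList ∘ block) n) (headSrc n)
  blocks-run zero    = subst (λ l → Run Step sP l (headSrc 0)) (sym (++-identityʳ preSteps))
                         (Run-map inj₁ (run (proj₂ (proj₂ pre))))
  blocks-run (suc n) = subst (λ l → Run Step sP l (headSrc (suc n))) splitting
                         (Run-++ (blocks-run n) (block-run n))
    where
    splitting : (preSteps ++ prefix (blockList ∘ block) n) ++ blockList (block n)
              ≡ preSteps ++ prefix (blockList ∘ block) (suc n)
    splitting = trans (++-assoc preSteps _ _) (cong (preSteps ++_) (sym (prefix-suc (blockList ∘ block) n)))

  run-upto : ∀ n → Run Step sP (applyUpTo ρ (pos n)) (headSrc n)
  run-upto n = subst (λ l → Run Step sP l (headSrc n)) (sym (applyUpTo-flatten preSteps block n)) (blocks-run n)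

  chained : ∀ i → Step (ρ i) × tgt (ρ i) ≡ src (ρ (suc i))
  chained i = run⇒chain ρ (pos (suc (suc i))) (run-upto (suc (suc i))) i (pos-grows (suc (suc i)))

  -- A balanced pair g_{i+1}, z_{i+1} leads into the accepting state.
  accepts : ∀ N → ∃[ i ] (N ≤ i × accepting (src (ρ i)) ≡ true)
  accepts N with inf N
  ... | i , N≤i , balanced = suc p , N≤1+p , cong accepting into-sZa
    where
    p = pos (suc i)
    N≤1+p : N ≤ suc p
    N≤1+p = ≤-trans N≤i (≤-trans (n≤1+n i) (≤-trans (pos-grows (suc i)) (n≤1+n p)))
    into-sZa : src (ρ (suc p)) ≡ sZa
    into-sZa = begin
      src (ρ (suc p))                ≡⟨ sym (proj₂ (chained p)) ⟩
      tgt (ρ p)                      ≡⟨ cong tgt (flatten-at preSteps block (suc i)) ⟩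
      closeTarget (proj₁ (tail i))   ≡⟨ cong closeTarget (balanced-end (proj₁ (proj₂ (tail i))) balanced) ⟩
      sZa                            ∎

  successful : IsSuccessfulComputation T ρ
  successful = (λ i → step∈Δ (proj₁ (chained i))) , run-start ρ (pos 1) (pos-grows 1) (run-upto 1)
             , (λ i → proj₂ (chained i)) , accepts

  -- Regrouped at the boundaries, the input of ρ is y₁ cut as in R₁; likewise the output.
  reads : ∀ y₁ → IsConcat y₁ (blocks₁ U u t vs g) → IsConcat y₁ (inLab ∘ ρ)
  reads y₁ = proj₂ (heads-regroup y₁ inLab (blocks₁ U u t vs g) first block-reads)
    where
    first : concatMap inLab (applyUpTo ρ (pos 0)) ≡ blocksA U ++ emb u
    first = begin
      concatMap inLab (applyUpTo ρ (pos 0))   ≡⟨ cong (concatMap inLab) (applyUpTo-flatten preSteps block 0) ⟩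
      concatMap inLab (preSteps ++ [])        ≡⟨ cong (concatMap inLab) (++-identityʳ preSteps) ⟩
      concatMap inLab preSteps                ≡⟨ proj₁ (labels (proj₂ (proj₂ pre))) ⟩
      blocksA U ++ emb u                      ∎
    block-reads : ∀ n → inLab (ρ (pos n)) ++ concatMap inLab (body n) ≡ blocks₁ U u t vs g (suc n)
    block-reads n = cong₂ (λ h l → inLab h ++ l) (flatten-at preSteps block n) (proj₁ (labels (proj₂ (proj₂ (tail n)))))

  writes : ∀ y₂ → IsConcat y₂ (blocks₂ V t us z) → IsConcat y₂ (outLab ∘ ρ)
  writes y₂ = proj₂ (tails-regroup y₂ outLab (blocks₂ V t us z) first block-writes)
    where
    first : concatMap outLab (applyUpTo ρ (suc (pos 0))) ≡ blocksA V
    first = begin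
      concatMap outLab (applyUpTo ρ (suc (pos 0)))
        ≡⟨ cong (concatMap outLab) (sym (applyUpTo-∷ʳ ρ (pos 0))) ⟩
      concatMap outLab (applyUpTo ρ (pos 0) ++ [ ρ (pos 0) ])
        ≡⟨ cong₂ (λ l h → concatMap outLab (l ++ [ h ])) (applyUpTo-flatten preSteps block 0) (flatten-at preSteps block 0) ⟩
      concatMap outLab ((preSteps ++ []) ++ [ head 0 ])
        ≡⟨ cong (λ l → concatMap outLab (l ++ [ head 0 ])) (++-identityʳ preSteps) ⟩
      concatMap outLab (preSteps ++ [ head 0 ])
        ≡⟨ concatMap-++ outLab preSteps [ head 0 ] ⟩
      concatMap outLab preSteps ++ []
        ≡⟨ ++-identityʳ _ ⟩
      concatMap outLab preSteps
        ≡⟨ proj₂ (labels (proj₂ (proj₂ pre))) ⟩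
      blocksA V ++ []
        ≡⟨ ++-identityʳ (blocksA V) ⟩
      blocksA V ∎
    block-writes : ∀ n → concatMap outLab (body n) ++ outLab (ρ (pos (suc n))) ≡ blocks₂ V t us z (suc n)
    block-writes n = begin
      concatMap outLab (body n) ++ outLab (ρ (pos (suc n)))
        ≡⟨ cong₂ (λ l h → l ++ outLab h) (proj₂ (labels (proj₂ (proj₂ (tail n))))) (flatten-at preSteps block (suc n)) ⟩
      tailOut n ++ [ A ]
        ≡⟨ ++-assoc (emb (us (suc n))) _ [ A ] ⟩
      blocks₂ V t us z (suc n) ∎

  accepted : ∀ y₁ y₂ → IsConcat y₁ (blocks₁ U u t vs g) → IsConcat y₂ (blocks₂ V t us z) → Rel∞ T y₁ y₂
  accepted y₁ y₂ c₁ c₂ = ρ , successful , reads y₁ c₁ , writes y₂ c₂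

module Backward (ρ : ℕ → Tr) (successful : IsSuccessfulComputation T ρ) where

  step : ∀ i → Step (ρ i)
  step i = Δ⇒step (proj₁ successful i)

  chain : ∀ i → tgt (ρ i) ≡ src (ρ (suc i))
  chain = proj₁ (proj₂ (proj₂ successful))

  into-accepting : ∀ j → accepting (src (ρ (suc j))) ≡ true → ¬ Inner (ρ j) × src (ρ j) ≡ sG
  into-accepting j acc = not-inner , from-sG (step j)
    where
    tgt≡sZa : tgt (ρ j) ≡ sZa
    tgt≡sZa = trans (chain j) (accepting⇒sZa _ acc)
    retarget : ∀ {P : Tr → Set} → P (ρ j) → P (src (ρ j) , inLab (ρ j) , outLab (ρ j) , sZa)
    retarget {P} = subst (λ q → P (src (ρ j) , inLab (ρ j) , outLab (ρ j) , q)) tgt≡sZa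
    not-inner : ¬ Inner (ρ j)
    not-inner x = inner-avoids-sZa (retarget {Inner} x)
    from-sG : Step (ρ j) → src (ρ j) ≡ sG
    from-sG (inj₁ x) = ⊥-elim (not-inner x)
    from-sG (inj₂ x) = boundary-into-sZa (retarget {Boundary} x)

  -- Accepting states recur, so from every N on there is a first boundary transition.
  next : ∀ N → FirstRight step N
  next N with proj₂ (proj₂ (proj₂ successful)) (suc N)
  ... | suc j , s≤s N≤j , acc = firstRight step N≤j (proj₁ (into-accepting j acc))

  b : ℕ → ℕ
  b zero    = FirstRight.at (next 0)
  b (suc n) = FirstRight.at (next (suc (b n)))

  b-increasing : ∀ n → b n < b (suc n)
  b-increasing n = FirstRight.from (next (suc (b n)))

  boundary : ∀ n → Boundary (ρ (b n))
  boundary zero    = FirstRight.right (next 0)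
  boundary (suc n) = FirstRight.right (next (suc (b n)))

  inner-between : ∀ n j → b n < j → j < b (suc n) → Inner (ρ j)
  inner-between n = FirstRight.leftBefore (next (suc (b n)))

  S : Segmentation ρ
  S = record
    { pos    = b
    ; body   = λ n → applyUpTo (λ i → ρ (suc (b n) + i)) (b (suc n) ∸ suc (b n))
    ; splits = λ n → applyUpTo-split ρ (b-increasing n)
    }

  open Segmentation S
  open Increasing b b-increasing

  prefix-run : Run Inner sP (applyUpTo ρ (b 0)) (src (ρ (b 0)))
  prefix-run = subst (λ s → Run Inner s (applyUpTo ρ (b 0)) (src (ρ (b 0)))) (proj₁ (proj₂ successful))
    (window⇒run ρ chain z≤n (λ j _ → FirstRight.leftBefore (next 0) j z≤n))

  body-run : ∀ n → Run Inner (tgt (ρ (b n))) (body n) (src (ρ (b (suc n))))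
  body-run n = subst (λ s → Run Inner s (body n) (src (ρ (b (suc n))))) (sym (chain (b n)))
    (window⇒run ρ chain (b-increasing n) (inner-between n))

  prefix-parse : ∃[ k ] Prefix (suc k) (applyUpTo ρ (b 0)) (src (ρ (b 0)))
  prefix-parse = parseP (boundary-exit (boundary 0)) prefix-run

  tail-parse : ∀ n → Tail (body n) (src (ρ (b (suc n))))
  tail-parse n = parseZ (boundary-target (boundary n)) (boundary-exit (boundary (suc n))) (body-run n)

  k : ℕ
  k = proj₁ prefix-parse

  open Prefix (proj₂ prefix-parse) using (U; V; u)

  t : ℕ → Bit
  t zero    = b0
  t (suc m) = interleave (λ n → proj₁ (boundary-letter (boundary n))) (λ n → Tail.a (tail-parse n)) m

  us vs g z : ℕ → List Bit
  us zero    = []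
  us (suc n) = Tail.us (tail-parse n)
  vs zero    = []
  vs (suc n) = Tail.vs (tail-parse n)
  g  zero    = []
  g  (suc n) = Tail.g (tail-parse n)
  z  zero    = []
  z  (suc n) = Tail.z (tail-parse n)

  cond : ∀ i → IsZeros (us (suc i)) × IsZeros (vs (suc i))
             × length (vs (suc i)) ≡ length (us (suc i)) × LengthCond (g (suc i)) (z (suc i))
  cond i = us-zeros , vs-zeros , same-length , balance⇒cond balance
    where open Tail (tail-parse i)

  accepting-block : ∀ N j → b (suc N) ≤ j → accepting (src (ρ (suc j))) ≡ true → ∃[ i ] (N ≤ i × b (suc i) ≡ j)
  accepting-block N j bN≤j acc with locate j (≤-trans (mono {0} {suc N} z≤n) bN≤j)
  ... | n , bn≤j , j<b with m≤n⇒m<n∨m≡n bn≤j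
  ...   | inj₁ bn<j = ⊥-elim (proj₁ (into-accepting j acc) (inner-between n j bn<j j<b))
  ...   | inj₂ bn≡j with n <? suc N
  ...     | yes n<1+N = ⊥-elim (<-irrefl bn≡j (<-≤-trans (strict n<1+N) bN≤j))
  ...     | no  n≮1+N with ≮⇒≥ n≮1+N
  ...       | s≤s N≤i = _ , N≤i , bn≡j

  balanced-infinitely : ∀ N → ∃[ i ] (N ≤ i × length (g (suc i)) ≡ length (z (suc i)))
  balanced-infinitely N with proj₂ (proj₂ (proj₂ successful)) (suc (b (suc N)))
  ... | suc j , s≤s bN≤j , acc with accepting-block N j bN≤j acc
  ...   | i , N≤i , refl =
    i , N≤i , balanced-at-sG (subst (Balance (g (suc i)) (z (suc i))) (proj₂ (into-accepting j acc))
                                     (Tail.balance (tail-parse i)))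

  reads : ∀ y₁ → IsConcat y₁ (inLab ∘ ρ) → IsConcat y₁ (blocks₁ U u t vs g)
  reads y₁ = proj₁ (heads-regroup y₁ inLab (blocks₁ U u t vs g) (proj₁ (Prefix.labels (proj₂ prefix-parse))) block-reads)
    where
    open SegmentationProperties S
    block-reads : ∀ n → inLab (ρ (b n)) ++ concatMap inLab (body n) ≡ blocks₁ U u t vs g (suc n)
    block-reads n = begin
      inLab (ρ (b n)) ++ concatMap inLab (body n)
        ≡⟨ cong₂ _++_ (proj₂ (boundary-letter (boundary n))) (proj₁ (Tail.labels (tail-parse n))) ⟩
      ⟨ proj₁ (boundary-letter (boundary n)) ⟩ ∷ emb (vs (suc n)) ++ A ∷ emb (g (suc n))
        ≡⟨ cong (λ a → ⟨ a ⟩ ∷ emb (vs (suc n)) ++ A ∷ emb (g (suc n))) (sym (interleave-even _ _ n)) ⟩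
      blocks₁ U u t vs g (suc n) ∎

  writes : ∀ y₂ → IsConcat y₂ (outLab ∘ ρ) → IsConcat y₂ (blocks₂ V t us z)
  writes y₂ = proj₁ (tails-regroup y₂ outLab (blocks₂ V t us z) first block-writes)
    where
    open SegmentationProperties S
    first : concatMap outLab (applyUpTo ρ (suc (b 0))) ≡ blocksA V
    first = begin
      concatMap outLab (applyUpTo ρ (suc (b 0)))
        ≡⟨ cong (concatMap outLab) (sym (applyUpTo-∷ʳ ρ (b 0))) ⟩
      concatMap outLab (applyUpTo ρ (b 0) ++ [ ρ (b 0) ])
        ≡⟨ concatMap-++ outLab (applyUpTo ρ (b 0)) [ ρ (b 0) ] ⟩
      concatMap outLab (applyUpTo ρ (b 0)) ++ outLab (ρ (b 0)) ++ []
        ≡⟨ cong₂ (λ l o → l ++ o ++ []) (proj₂ (Prefix.labels (proj₂ prefix-parse)))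
                  (boundary-silent (boundary 0) (Prefix.ends (proj₂ prefix-parse))) ⟩
      blocksA V ++ []
        ≡⟨ ++-identityʳ (blocksA V) ⟩
      blocksA V ∎
    block-writes : ∀ n → concatMap outLab (body n) ++ outLab (ρ (b (suc n))) ≡ blocks₂ V t us z (suc n)
    block-writes n = begin
      concatMap outLab (body n) ++ outLab (ρ (b (suc n)))
        ≡⟨ cong₂ _++_ (proj₂ (Tail.labels (tail-parse n)))
                      (boundary-closes (boundary (suc n)) (Tail.balance (tail-parse n))) ⟩
      (emb (us (suc n)) ++ ⟨ Tail.a (tail-parse n) ⟩ ∷ emb (z (suc n))) ++ [ A ]
        ≡⟨ ++-assoc (emb (us (suc n))) _ [ A ] ⟩
      emb (us (suc n)) ++ ⟨ Tail.a (tail-parse n) ⟩ ∷ emb (z (suc n)) ++ [ A ]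
        ≡⟨ cong (λ a → emb (us (suc n)) ++ ⟨ a ⟩ ∷ emb (z (suc n)) ++ [ A ]) (sym (interleave-odd _ _ n)) ⟩
      blocks₂ V t us z (suc n) ∎

  related : ∀ y₁ y₂ → IsConcat y₁ (inLab ∘ ρ) → IsConcat y₂ (outLab ∘ ρ) → R₁ y₁ y₂
  related y₁ y₂ c₁ c₂ =
    suc k , s≤s z≤n , U , V , u , t , us , vs , g , z , cond , balanced-infinitely , reads y₁ c₁ , writes y₂ c₂

lemma12 : IsInfinitaryRational R₁
lemma12 = T , λ y₁ y₂ → R₁⇒Rel∞ y₁ y₂ , Rel∞⇒R₁ y₁ y₂
  where
  R₁⇒Rel∞ : ∀ y₁ y₂ → R₁ y₁ y₂ → Rel∞ T y₁ y₂
  R₁⇒Rel∞ y₁ y₂ (suc k , _ , U , V , u , t , us , vs , g , z , cond , inf , c₁ , c₂) =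
    Forward.accepted U V u t us vs g z cond inf y₁ y₂ c₁ c₂
  Rel∞⇒R₁ : ∀ y₁ y₂ → Rel∞ T y₁ y₂ → R₁ y₁ y₂
  Rel∞⇒R₁ y₁ y₂ (ρ , successful , c₁ , c₂) = Backward.related ρ successful y₁ y₂ c₁ c₂
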